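{- Let $k$ be a field with $\operatorname{char}(k)\neq 2,3$ and let $E$ be the elliptic curve $y^2=x^3-27$ over $k$. If there exists a non-trivial arithmetic progression of three cubes in $k$, then there is an affine point $(x,y)\in E(k)$ with $x\neq 3$; equivalently, $E(k)$ strictly contains the subgroup $\{O,(3,0)\}\cong\mathbb{Z}/2\mathbb{Z}$.
   Context: An arithmetic progression of three cubes in $k$ is a triple $x_0^3,x_1^3,x_2^3$ with $x_0,x_1,x_2\in k$ not all zero and $x_1^3-x_0^3=x_2^3-x_1^3$. It is called trivial if it is constant ($x_0^3=x_1^3=x_2^3$) or proportional to the progression $-1,0,1$ (i.e. $x_1=0$); otherwise it is non-trivial. $O$ denotes the point at infinity of $E$. -}

module Defs where

open import Level using (Level; suc; _⊔_)
open import Algebra.Bundles using (CommutativeRing)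
open import Data.Product using (∃; _×_)
open import Data.Sum using (_⊎_)
open import Relation.Nullary using (¬_)

record Field (c ℓ : Level) : Set (suc (c ⊔ ℓ)) where
  field
    commutativeRing : CommutativeRing c ℓ
  open CommutativeRing commutativeRing public
  field
    1≉0     : ¬ (1# ≈ 0#)
    inverse : ∀ x → ¬ (x ≈ 0#) → ∃ λ y → x * y ≈ 1#

module FieldNotions {c ℓ : Level} (F : Field c ℓ) where
  open Field F

  2# : Carrier
  2# = 1# + 1#

  3# : Carrier
  3# = 1# + 1# + 1#

  27# : Carrier
  27# = 3# * 3# * 3#

  cube : Carrier → Carrier
  cube x = x * x * x

  CharNot2or3 : Set ℓ
  CharNot2or3 = ¬ (2# ≈ 0#) × ¬ (3# ≈ 0#)

  IsAPCubes : Carrier → Carrier → Carrier → Set ℓ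
  IsAPCubes x0 x1 x2 =
    ¬ (x0 ≈ 0# × x1 ≈ 0# × x2 ≈ 0#) × (cube x1 - cube x0 ≈ cube x2 - cube x1)

  -- trivial: constant, or proportional to -1,0,1 (i.e. x1 = 0)
  TrivialAP : Carrier → Carrier → Carrier → Set ℓ
  TrivialAP x0 x1 x2 = (cube x0 ≈ cube x1 × cube x1 ≈ cube x2) ⊎ (x1 ≈ 0#)

  NonTrivialAPCubes : Set (c ⊔ ℓ)
  NonTrivialAPCubes = ∃ λ x0 → ∃ λ x1 → ∃ λ x2 →
    IsAPCubes x0 x1 x2 × ¬ TrivialAP x0 x1 x2

  OnE : Carrier → Carrier → Set ℓ
  OnE x y = y * y ≈ cube x - 27#

{-# OPTIONS --safe #-}
module Submission where

-- From x₀³ + x₂³ = 2x₁³, with s = x₀ + x₂ and d = x₀ − x₂, one gets 8x₁³ = s(s² + 3d²),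
-- so s ≠ 0 because x₁ ≠ 0. The point (6x₁/s, 9d/s) lies on y² = x³ − 27, since
-- x³ = 27(s² + 3d²)/s² = 27 + y². If its abscissa were 3, then 2x₁ = s, hence
-- s³ = s³ + 3sd², which forces d = 0 and then x₀ = x₁ = x₂: the progression is constant.

open import Defs
open import Level using (Level)
open import Data.Product using (∃; _×_; _,_)
open import Data.Sum using (inj₁; inj₂)
open import Relation.Nullary using (¬_)
open import Function using (_∘_)
import Algebra.Properties.Ring as RingProperties
import Algebra.Solver.Ring.NaturalCoefficients.Default as NaturalCoefficientsSolver
import Relation.Binary.Reasoning.Setoid as SetoidReasoning

module FieldLemmas {c ℓ : Level} (F : Field c ℓ) where
  open Field F
  open FieldNotions F
  open RingProperties ring using (//-rightDividesˡ; x∙y⁻¹≈ε⇒x≈y; //-rightDividesʳ; +-identityʳ-unique)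
  open NaturalCoefficientsSolver commutativeSemiring using (solve; _:=_; _:+_; _:*_; con)
  open SetoidReasoning setoid

  *-cancelˡ-≉0 : ∀ {x y z} → x ≉ 0# → x * y ≈ x * z → y ≈ z
  *-cancelˡ-≉0 {x} {y} {z} x≉0 xy≈xz with inverse x x≉0
  ... | x⁻¹ , xx⁻¹≈1 = begin
    y              ≈⟨ *-identityˡ y ⟨
    1# * y         ≈⟨ *-congʳ xx⁻¹≈1 ⟨
    x * x⁻¹ * y    ≈⟨ solve 3 (λ x x⁻¹ y → x :* x⁻¹ :* y := x⁻¹ :* (x :* y)) refl x x⁻¹ y ⟩
    x⁻¹ * (x * y)  ≈⟨ *-congˡ xy≈xz ⟩
    x⁻¹ * (x * z)  ≈⟨ solve 3 (λ x x⁻¹ z → x⁻¹ :* (x :* z) := x :* x⁻¹ :* z) refl x x⁻¹ z ⟩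
    x * x⁻¹ * z    ≈⟨ *-congʳ xx⁻¹≈1 ⟩
    1# * z         ≈⟨ *-identityˡ z ⟩
    z              ∎

  x≉0∧x*y≈0⇒y≈0 : ∀ {x y} → x ≉ 0# → x * y ≈ 0# → y ≈ 0#
  x≉0∧x*y≈0⇒y≈0 {x} x≉0 xy≈0 = *-cancelˡ-≉0 x≉0 (trans xy≈0 (sym (zeroʳ x)))

  *-≉0 : ∀ {x y} → x ≉ 0# → y ≉ 0# → x * y ≉ 0#
  *-≉0 x≉0 y≉0 xy≈0 = y≉0 (x≉0∧x*y≈0⇒y≈0 x≉0 xy≈0)

  x*y≈1⇒x≉0 : ∀ {x y} → x * y ≈ 1# → x ≉ 0#
  x*y≈1⇒x≉0 {x} {y} xy≈1 x≈0 = 1≉0 (begin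
    1#      ≈⟨ xy≈1 ⟨
    x * y   ≈⟨ *-congʳ x≈0 ⟩
    0# * y  ≈⟨ zeroˡ y ⟩
    0#      ∎)

  cube-≉0 : ∀ {x} → x ≉ 0# → cube x ≉ 0#
  cube-≉0 x≉0 = *-≉0 (*-≉0 x≉0 x≉0) x≉0

  cube-cong : ∀ {x y} → x ≈ y → cube x ≈ cube y
  cube-cong x≈y = *-cong (*-cong x≈y x≈y) x≈y

  p-q≈r-p⇒q+r≈2p : ∀ {p q r} → p - q ≈ r - p → q + r ≈ 2# * p
  p-q≈r-p⇒q+r≈2p {p} {q} {r} eq = begin
    q + r              ≈⟨ +-congˡ (//-rightDividesˡ p r) ⟨
    q + (r - p + p)    ≈⟨ +-congˡ (+-congʳ eq) ⟨
    q + (p - q + p)    ≈⟨ solve 3 (λ q u p → q :+ (u :+ p) := u :+ q :+ p) refl q (p - q) p ⟩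
    p - q + q + p      ≈⟨ +-congʳ (//-rightDividesˡ q p) ⟩
    p + p              ≈⟨ solve 1 (λ p → p :+ p := con 2 :* p) refl p ⟩
    2# * p             ∎

  sum-of-cubes-factorisation : ∀ u v →
    2# * 2# * (cube u + cube v) ≈ (u + v) * ((u + v) * (u + v) + 3# * ((u - v) * (u - v)))
  sum-of-cubes-factorisation u v = begin
    2# * 2# * (cube u + cube v)
      ≈⟨ *-congˡ (+-congʳ (cube-cong u≈d+v)) ⟩
    2# * 2# * (cube (d + v) + cube v)
      ≈⟨ solve 2 (λ d v → con 2 :* con 2 :* ((d :+ v) :* (d :+ v) :* (d :+ v) :+ v :* v :* v)
                        := (d :+ v :+ v) :* ((d :+ v :+ v) :* (d :+ v :+ v) :+ con 3 :* (d :* d))) refl d v ⟩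
    (d + v + v) * ((d + v + v) * (d + v + v) + 3# * (d * d))
      ≈⟨ *-cong u+v≈d+v+v (+-congʳ (*-cong u+v≈d+v+v u+v≈d+v+v)) ⟨
    (u + v) * ((u + v) * (u + v) + 3# * (d * d)) ∎
    where
    d : Carrier
    d = u - v
    u≈d+v : u ≈ d + v
    u≈d+v = sym (//-rightDividesˡ v u)
    u+v≈d+v+v : u + v ≈ d + v + v
    u+v≈d+v+v = +-congʳ u≈d+v

  point-on-E : ∀ {b s d i} → 2# * 2# * (2# * cube b) ≈ s * (s * s + 3# * (d * d)) → s * i ≈ 1# →
               OnE (2# * 3# * b * i) (3# * 3# * d * i)
  point-on-E {b} {s} {d} {i} 8b³≈s[s²+3d²] s*i≈1 = begin
    y * y                   ≈⟨ //-rightDividesʳ 27# (y * y) ⟨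
    y * y + 27# - 27#       ≈⟨ +-congʳ cube-x≈y²+27 ⟨
    cube x - 27#            ∎
    where
    x y : Carrier
    x = 2# * 3# * b * i
    y = 3# * 3# * d * i
    cube-x≈y²+27 : cube x ≈ y * y + 27#
    cube-x≈y²+27 = begin
      cube x
        ≈⟨ solve 2 (λ b i → (con 2 :* con 3 :* b :* i) :* (con 2 :* con 3 :* b :* i)
                                :* (con 2 :* con 3 :* b :* i)
                         := con 3 :* con 3 :* con 3 :* (con 2 :* con 2 :* (con 2 :* (b :* b :* b)))
                                :* (i :* i :* i)) refl b i ⟩
      27# * (2# * 2# * (2# * cube b)) * (i * i * i)
        ≈⟨ *-congʳ (*-congˡ 8b³≈s[s²+3d²]) ⟩
      27# * (s * (s * s + 3# * (d * d))) * (i * i * i)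
        ≈⟨ solve 3 (λ s d i → con 3 :* con 3 :* con 3 :* (s :* (s :* s :+ con 3 :* (d :* d))) :* (i :* i :* i)
                           := con 3 :* con 3 :* con 3
                                :* ((s :* i) :* (s :* i) :* (s :* i) :+ con 3 :* (d :* i) :* (d :* i) :* (s :* i)))
                   refl s d i ⟩
      27# * ((s * i) * (s * i) * (s * i) + 3# * (d * i) * (d * i) * (s * i))
        ≈⟨ *-congˡ (+-cong (cube-cong s*i≈1) (*-congˡ s*i≈1)) ⟩
      27# * (1# * 1# * 1# + 3# * (d * i) * (d * i) * 1#)
        ≈⟨ solve 2 (λ d i → con 3 :* con 3 :* con 3
                                :* (con 1 :* con 1 :* con 1 :+ con 3 :* (d :* i) :* (d :* i) :* con 1)
                         := (con 3 :* con 3 :* d :* i) :* (con 3 :* con 3 :* d :* i) :+ con 3 :* con 3 :* con 3)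
                   refl d i ⟩
      y * y + 27#
        ∎

  abscissa≈3⇒2b≈s : ∀ {b s i} → 3# ≉ 0# → s * i ≈ 1# → 2# * 3# * b * i ≈ 3# → 2# * b ≈ s
  abscissa≈3⇒2b≈s {b} {s} {i} 3≉0 s*i≈1 x≈3 = *-cancelˡ-≉0 3≉0 (begin
    3# * (2# * b)              ≈⟨ *-identityʳ _ ⟨
    3# * (2# * b) * 1#         ≈⟨ *-congˡ s*i≈1 ⟨
    3# * (2# * b) * (s * i)    ≈⟨ solve 3 (λ b s i → con 3 :* (con 2 :* b) :* (s :* i)
                                                  := (con 2 :* con 3 :* b :* i) :* s) refl b s i ⟩
    (2# * 3# * b * i) * s      ≈⟨ *-congʳ x≈3 ⟩
    3# * s                     ∎)

  2b≈s⇒d²≈0 : ∀ {b s d} → 3# ≉ 0# → s ≉ 0# → 2# * 2# * (2# * cube b) ≈ s * (s * s + 3# * (d * d)) →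
              2# * b ≈ s → d * d ≈ 0#
  2b≈s⇒d²≈0 {b} {s} {d} 3≉0 s≉0 8b³≈s[s²+3d²] 2b≈s =
    x≉0∧x*y≈0⇒y≈0 s≉0 (x≉0∧x*y≈0⇒y≈0 3≉0 (+-identityʳ-unique (cube s) _ s³+3sd²≈s³))
    where
    s³+3sd²≈s³ : cube s + 3# * (s * (d * d)) ≈ cube s
    s³+3sd²≈s³ = begin
      cube s + 3# * (s * (d * d))  ≈⟨ solve 2 (λ s d → s :* s :* s :+ con 3 :* (s :* (d :* d))
                                                    := s :* (s :* s :+ con 3 :* (d :* d))) refl s d ⟩
      s * (s * s + 3# * (d * d))   ≈⟨ 8b³≈s[s²+3d²] ⟨
      2# * 2# * (2# * cube b)      ≈⟨ solve 1 (λ b → con 2 :* con 2 :* (con 2 :* (b :* b :* b))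
                                                  := (con 2 :* b) :* (con 2 :* b) :* (con 2 :* b)) refl b ⟩
      cube (2# * b)                ≈⟨ cube-cong 2b≈s ⟩
      cube s                       ∎

  2b≈a+c∧a-c≈0⇒trivial : ∀ {a b c} → 2# ≉ 0# → 2# * b ≈ a + c → a - c ≈ 0# → TrivialAP a b c
  2b≈a+c∧a-c≈0⇒trivial {a} {b} {c} 2≉0 2b≈a+c a-c≈0 =
    inj₁ (cube-cong (trans a≈c (sym b≈c)) , cube-cong b≈c)
    where
    a≈c : a ≈ c
    a≈c = x∙y⁻¹≈ε⇒x≈y a c a-c≈0
    b≈c : b ≈ c
    b≈c = *-cancelˡ-≉0 2≉0 (begin
      2# * b  ≈⟨ 2b≈a+c ⟩
      a + c   ≈⟨ +-congʳ a≈c ⟩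
      c + c   ≈⟨ solve 1 (λ c → c :+ c := con 2 :* c) refl c ⟩
      2# * c  ∎)

corollary2 : ∀ {c ℓ : Level} (F : Field c ℓ) →
    let open Field F
        open FieldNotions F
    in CharNot2or3 → NonTrivialAPCubes →
       ∃ λ x → ∃ λ y → OnE x y × ¬ (x ≈ 3#)
corollary2 F (2≉0 , 3≉0) (a , b , c , (_ , ap) , nontrivial) = point (inverse (a + c) s≉0)
  where
  open Field F
  open FieldNotions F
  open FieldLemmas F

  8b³≈s[s²+3d²] : 2# * 2# * (2# * cube b) ≈ (a + c) * ((a + c) * (a + c) + 3# * ((a - c) * (a - c)))
  8b³≈s[s²+3d²] = trans (*-congˡ (sym (p-q≈r-p⇒q+r≈2p ap))) (sum-of-cubes-factorisation a c)

  s≉0 : a + c ≉ 0#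
  s≉0 s≈0 = *-≉0 (*-≉0 2≉0 2≉0) (*-≉0 2≉0 (cube-≉0 (nontrivial ∘ inj₂)))
              (trans 8b³≈s[s²+3d²] (trans (*-congʳ s≈0) (zeroˡ _)))

  point : (∃ λ i → (a + c) * i ≈ 1#) → ∃ λ x → ∃ λ y → OnE x y × ¬ (x ≈ 3#)
  point (i , s*i≈1) = 2# * 3# * b * i , 3# * 3# * (a - c) * i , point-on-E 8b³≈s[s²+3d²] s*i≈1 , x≉3
    where
    x≉3 : ¬ (2# * 3# * b * i ≈ 3#)
    x≉3 x≈3 = *-≉0 d≉0 d≉0 (2b≈s⇒d²≈0 3≉0 s≉0 8b³≈s[s²+3d²] 2b≈s)
      where
      2b≈s : 2# * b ≈ a + c
      2b≈s = abscissa≈3⇒2b≈s 3≉0 s*i≈1 x≈3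
      d≉0 : a - c ≉ 0#
      d≉0 = nontrivial ∘ 2b≈a+c∧a-c≈0⇒trivial 2≉0 2b≈s
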